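{- Let $G$ be a finite simple graph, regarded as a simplicial complex, with $f_1(G)\neq 0$ (i.e. $G$ has at least one edge), and for $j\ge 1$ let $\mathcal{K}^{j+1} = C^j(G)$ be the $j$-fold iterated cone on $G$ (a $(j+1)$-dimensional simplicial complex). Then for all sufficiently large $j$, the complex $\mathcal{K}^{j+1}$ is not dual to a polytope satisfying the $g$-theorem; that is, there is no simple convex $(j+2)$-dimensional polytope $P$ whose dual simplicial complex $\mathcal{K}_P$ is isomorphic to $\mathcal{K}^{j+1}$.
   Context: A simplicial complex on a finite set $X$ is a non-empty collection of subsets of $X$ closed under taking subsets; a simple graph is a simplicial complex whose simplices are $\emptyset$, its vertices, and its edges. $f_i$ denotes the number of $i$-dimensional simplices (simplices of cardinality $i+1$). The cone on a simplicial complex $\mathcal{K}$ on $X$ is $C(\mathcal{K})=\{x\cup\{c\}: x\in\mathcal{K}\}\cup\mathcal{K}$ for a new vertex $c\notin X$; $C^j$ denotes the $j$-fold iterate, each time with a new cone vertex. A convex polytope is the convex hull of a non-empty finite set of points in $\mathbb{R}^q$; an $n$-dimensional polytope is simple if every vertex is the intersection of exactly $n$ facets (codimension-one faces). For a simple $n$-polytope $P$ with facets $F_1,\ldots,F_m$, its dual simplicial complex $\mathcal{K}_P$ has vertex set $\{F_1,\ldots,F_m\}$, and a set $\{F_{i_0},\ldots,F_{i_k}\}$ is a simplex of $\mathcal{K}_P$ iff $F_{i_0}\cap\cdots\cap F_{i_k}\neq\emptyset$; it is an $(n-1)$-dimensional simplicial sphere. (By McMullen's conditions, the $g$-theorem,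 the $f$-vectors of simple polytopes are exactly those satisfying the $g$-theorem conditions.) -}

module Defs where

open import Level using (0ℓ)
open import Data.Nat as ℕ using (ℕ; zero; suc)
open import Data.Fin using (Fin; zero; suc)
open import Data.Fin.Subset using (Subset; ⁅_⁆; _∪_; ∣_∣; _∈_)
open import Data.Vec using (_∷_)
open import Data.Product using (Σ; ∃; ∃-syntax; _×_; _,_)
open import Data.Sum using (_⊎_)
open import Relation.Nullary using (¬_)
open import Relation.Binary.PropositionalEquality using (_≡_; _≢_)
open import Relation.Binary.Structures using (IsTotalOrder)
open import Algebra.Structures using (IsCommutativeRing)
open import Function.Bundles using (_⇔_; _↔_; Inverse)

-- Ordered fields (the ambient scalars; the paper uses ℝ, an instance)

record OrderedField : Set₁ where
  infixl 6 _+_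
  infixl 7 _*_
  infix 4 _≤_
  field
    Carrier : Set
    _+_ _*_ : Carrier → Carrier → Carrier
    -_ : Carrier → Carrier
    0# 1# : Carrier
    isCommutativeRing : IsCommutativeRing _≡_ _+_ _*_ -_ 0# 1#
    _≤_ : Carrier → Carrier → Set
    isTotalOrder : IsTotalOrder _≡_ _≤_
    +-monoˡ-≤ : ∀ {a b} c → a ≤ b → a + c ≤ b + c
    *-nonneg : ∀ {a b} → 0# ≤ a → 0# ≤ b → 0# ≤ a * b
    0≢1 : 0# ≢ 1#
    inverse : ∀ a → a ≢ 0# → ∃ λ b → a * b ≡ 1#

SC : ℕ → Set₁
SC k = Subset k → Set

-- cone with new vertex 'zero': simplices are x and x ∪ {c} for x ∈ K
Cone : ∀ {k} → SC k → SC (suc k)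
Cone K (b ∷ s) = K s

iterCone : ∀ {k} (j : ℕ) → SC k → SC (j ℕ.+ k)
iterCone zero    K = K
iterCone (suc j) K = Cone (iterCone j K)

record SimpleGraph (n : ℕ) : Set₁ where
  field
    Adj : Fin n → Fin n → Set
    irrefl : ∀ u → ¬ Adj u u
    sym : ∀ {u v} → Adj u v → Adj v u

HasEdge : ∀ {n} → SimpleGraph n → Set
HasEdge G = ∃[ u ] ∃[ v ] SimpleGraph.Adj G u v

graphComplex : ∀ {n} → SimpleGraph n → SC n
graphComplex G s =
  (∣ s ∣ ℕ.≤ 1) ⊎ (∃[ u ] ∃[ v ] (SimpleGraph.Adj G u v × s ≡ ⁅ u ⁆ ∪ ⁅ v ⁆))

module Geometry (F : OrderedField) where
  open OrderedField F

  Point : ℕ → Set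
  Point q = Fin q → Carrier

  sumF : ∀ {k} → (Fin k → Carrier) → Carrier
  sumF {zero}  f = 0#
  sumF {suc k} f = f zero + sumF (λ i → f (suc i))

  _·_ : ∀ {q} → Point q → Point q → Carrier
  a · x = sumF (λ i → a i * x i)

  _≐_ : ∀ {q} → Point q → Point q → Set
  x ≐ y = ∀ i → x i ≡ y i

  PointSet : ℕ → Set₁
  PointSet q = Point q → Set

  Conv : ∀ {q k} → (Fin k → Point q) → PointSet q
  Conv {q} {k} V x = ∃[ w ] ((∀ i → 0# ≤ w i) × sumF w ≡ 1#
                              × (∀ c → x c ≡ sumF (λ i → w i * V i c)))

  AffInd : ∀ {q r} → (Fin (suc r) → Point q) → Set
  AffInd p = ∀ μ → sumF μ ≡ 0# → (∀ c → sumF (λ i → μ i * p i c) ≡ 0#)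
             → ∀ i → μ i ≡ 0#

  HasDim : ∀ {q} → PointSet q → ℕ → Set
  HasDim S d = (∃[ p ] ((∀ i → S (p i)) × AffInd {r = d} p))
             × (∀ p → (∀ i → S (p i)) → ¬ AffInd {r = suc d} p)

  Supporting : ∀ {q} → PointSet q → Point q → Carrier → Set
  Supporting P a b = ∀ x → P x → a · x ≤ b

  Face : ∀ {q} → PointSet q → Point q → Carrier → PointSet q
  Face P a b x = P x × a · x ≡ b

  SameSet : ∀ {q} → PointSet q → PointSet q → Set
  SameSet S T = ∀ x → S x ⇔ T x

  -- facets of an (suc d)-dimensional polytope: faces of dimension d
  IsFacet : ∀ {q} → PointSet q → ℕ → Point q → Carrier → Set
  IsFacet P d a b = Supporting P a b × HasDim (Face P a b) d

  IsVertex : ∀ {q} → PointSet q → Point q → Set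
  IsVertex P v = ∃[ a ] ∃[ b ] (Supporting P a b
                   × (∀ x → Face P a b x ⇔ x ≐ v))

  record FacetEnum {q} (P : PointSet q) (d : ℕ) (m : ℕ) : Set where
    field
      normal : Fin m → Point q
      offset : Fin m → Carrier
      isFacet : ∀ i → IsFacet P d (normal i) (offset i)
      distinct : ∀ i i' → i ≢ i'
                 → ¬ SameSet (Face P (normal i) (offset i)) (Face P (normal i') (offset i'))
      complete : ∀ a b → IsFacet P d a b
                 → ∃[ i ] SameSet (Face P a b) (Face P (normal i) (offset i))
    facet : Fin m → PointSet q
    facet i = Face P (normal i) (offset i)

  IsSimple : ∀ {q m} (P : PointSet q) (d : ℕ) → FacetEnum P d m → Set
  IsSimple {m = m} P d E =
    ∀ v → IsVertex P v →
      Σ (Fin (suc d) → Fin m) λ ι → ((∀ k k' → ι k ≡ ι k' → k ≡ k')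
             × (∀ i → FacetEnum.facet E i v ⇔ (∃[ k ] (ι k ≡ i))))

  DualIso : ∀ {q m} (P : PointSet q) {d : ℕ} → FacetEnum P d m → ∀ {N} → SC N → Set
  DualIso {m = m} P E {N} K =
    Σ (Fin m ↔ Fin N) λ φ →
      ∀ (T : Subset N) →
        K T ⇔ (∃[ x ] (P x × (∀ v → v ∈ T → FacetEnum.facet E (Inverse.from φ v) x)))

  DualToSimplePolytope : ℕ → ∀ {N} → SC N → Set
  DualToSimplePolytope d K =
    ∃[ q ] ∃[ k ] Σ (Fin (suc k) → Point q) λ V →
      HasDim (Conv V) (suc d) ×
      (∃[ m ] Σ (FacetEnum (Conv V) d m) λ E →
        IsSimple (Conv V) d E × DualIso (Conv V) E K)

-- Let c be the apex of the cone C(K) and F_c the facet of P dual to it. Some vertex v of P lies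
-- off F_c, for otherwise all of P would lie in the hyperplane of F_c. As P is simple, the n facets
-- through v form a simplex of C(K) with n vertices avoiding c, i.e. a simplex of K. For
-- K = C^(j-1)(G) with j ≥ 1 and n = j + 2 this is impossible, since the simplices of K have at most
-- j + 1 vertices.
--
-- Over an ordered field the vertex off F_c is found as follows: if A·x ≤ B is the facet inequality
-- and A·V_j < B for a generating point V_j, put h = B - A·V_j. The generating point v maximising the
-- strictly convex function h∥y∥² - K (A·y) is exposed by the gradient of this function at v, and for
-- K > max ∥V_i∥² it cannot lie on the hyperplane A·x = B.

module Submission where

open import Defs
open import Algebra.Bundles using (CommutativeRing)
open import Algebra.Solver.Ring.AlmostCommutativeRing using (_-Raw-AlmostCommutative⟶_; fromCommutativeRing)
open import Data.Fin using (Fin; zero; suc; _≟_)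
open import Data.Fin.Properties using (any?; suc-injective; 0≢1+n; ¬∀⟶∃¬; sequence)
open import Data.Fin.Subset using (Subset; ⁅_⁆; _∪_; ∣_∣; _∈_; _∉_; inside; outside)
open import Data.Fin.Subset.Properties using (∣⁅x⁆∣≡1; x∈p⇒∣p-x∣<∣p∣; x∈p∧x≢y⇒x∈p-y)
open import Data.Integer as ℤ using (ℤ; -[1+_])
import Data.Integer.Properties as ℤ
open import Data.List using (allFin)
import Data.List.Extrema as Extrema
open import Data.List.Membership.Propositional.Properties using (∈-allFin)
import Data.List.Relation.Unary.Any as Any
import Data.Maybe as Maybe
open import Data.Nat as ℕ using (ℕ; zero; suc; z≤n; s≤s)
import Data.Nat.Properties as ℕ
open import Data.Product using (∃-syntax; _×_; _,_; proj₁; proj₂)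
open import Data.Sum using (inj₁; inj₂)
open import Data.Vec using (_∷_; []; here; tabulate)
open import Data.Vec.Properties using (lookup∘tabulate; []=⇒lookup; lookup⇒[]=)
open import Effect.Monad using (RawMonad)
open import Function using (_∘_)
open import Function.Bundles using (Inverse; Equivalence; Injection; mk⇔)
open import Function.Definitions using (Injective)
open import Function.Properties.Inverse using (↔⇒↣)
open import Level using (0ℓ)
open import Relation.Binary.Bundles using (TotalOrder)
open import Relation.Binary.PropositionalEquality
  using (_≡_; _≢_; refl; sym; trans; cong; cong₂; subst; subst₂; module ≡-Reasoning)
import Relation.Binary.Reasoning.PartialOrder as PosetReasoning
open import Relation.Nullary using (¬_; Dec; does; yes; no; contradiction)
open import Relation.Nullary.Decidable using (dec⇒maybe; dec-true; ¬¬-excluded-middle)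
open import Relation.Nullary.Negation using (¬¬-Monad)

-- The ring solver needs coefficients with decidable equality, which the carrier of an ordered
-- field lacks, so it is run with coefficients in ℤ through the canonical map ℤ → R.
module IntegerCoefficientSolver {c ℓ} (R : CommutativeRing c ℓ) where
  open CommutativeRing R renaming (refl to ≈-refl; sym to ≈-sym; trans to ≈-trans)
  open import Algebra.Properties.Ring ring
    using (-‿involutive; -‿distribˡ-*; -‿distribʳ-*; -‿+-comm; -0#≈0#)
  import Algebra.Properties.Semiring.Mult semiring as Mult
  open import Algebra.Properties.CommutativeSemigroup +-commutativeSemigroup using (interchange)
  open import Relation.Binary.Reasoning.Setoid setoid

  ⟦_⟧ℕ : ℕ → Carrier
  ⟦ n ⟧ℕ = n Mult.× 1#

  ⟦_⟧ℤ : ℤ → Carrier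
  ⟦ ℤ.+ n ⟧ℤ     = ⟦ n ⟧ℕ
  ⟦ -[1+ n ] ⟧ℤ = - ⟦ suc n ⟧ℕ

  ⊖-homo : ∀ m n → ⟦ m ℤ.⊖ n ⟧ℤ ≈ ⟦ m ⟧ℕ - ⟦ n ⟧ℕ
  ⊖-homo zero    zero    = ≈-sym (-‿inverseʳ 0#)
  ⊖-homo zero    (suc n) = ≈-sym (+-identityˡ _)
  ⊖-homo (suc m) zero    = ≈-sym (≈-trans (+-congˡ -0#≈0#) (+-identityʳ _))
  ⊖-homo (suc m) (suc n) = begin
    ⟦ suc m ℤ.⊖ suc n ⟧ℤ              ≡⟨ cong ⟦_⟧ℤ (ℤ.[1+m]⊖[1+n]≡m⊖n m n) ⟩
    ⟦ m ℤ.⊖ n ⟧ℤ                      ≈⟨ ⊖-homo m n ⟩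
    ⟦ m ⟧ℕ - ⟦ n ⟧ℕ                 ≈⟨ cancel ⟦ m ⟧ℕ ⟦ n ⟧ℕ ⟨
    ⟦ suc m ⟧ℕ - ⟦ suc n ⟧ℕ         ∎
    where
    cancel : ∀ x y → (1# + x) - (1# + y) ≈ x - y
    cancel x y = begin
      (1# + x) - (1# + y)     ≈⟨ +-congˡ (-‿+-comm 1# y) ⟨
      (1# + x) + (- 1# - y)   ≈⟨ interchange 1# x (- 1#) (- y) ⟩
      (1# - 1#) + (x - y)     ≈⟨ +-congʳ (-‿inverseʳ 1#) ⟩
      0# + (x - y)            ≈⟨ +-identityˡ _ ⟩
      x - y                   ∎

  -‿homo : ∀ i → ⟦ ℤ.- i ⟧ℤ ≈ - ⟦ i ⟧ℤ
  -‿homo (ℤ.+ zero)    = ≈-sym -0#≈0#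
  -‿homo (ℤ.+ suc n)   = ≈-refl
  -‿homo -[1+ n ]    = ≈-sym (-‿involutive _)

  +-homo : ∀ i j → ⟦ i ℤ.+ j ⟧ℤ ≈ ⟦ i ⟧ℤ + ⟦ j ⟧ℤ
  +-homo (ℤ.+ m)    (ℤ.+ n)    = Mult.×-homo-+ 1# m n
  +-homo (ℤ.+ m)    -[1+ n ] = ⊖-homo m (suc n)
  +-homo -[1+ m ] (ℤ.+ n)    = ≈-trans (⊖-homo n (suc m)) (+-comm _ _)
  +-homo -[1+ m ] -[1+ n ] = begin
    - ⟦ suc (suc (m ℕ.+ n)) ⟧ℕ     ≡⟨ cong (λ k → - ⟦ suc k ⟧ℕ) (ℕ.+-suc m n) ⟨
    - (⟦ suc m ℕ.+ suc n ⟧ℕ)       ≈⟨ -‿cong (Mult.×-homo-+ 1# (suc m) (suc n)) ⟩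
    - (⟦ suc m ⟧ℕ + ⟦ suc n ⟧ℕ)      ≈⟨ -‿+-comm _ _ ⟨
    - ⟦ suc m ⟧ℕ - ⟦ suc n ⟧ℕ    ∎

  +-*-homo : ∀ m j → ⟦ ℤ.+ m ℤ.* j ⟧ℤ ≈ ⟦ ℤ.+ m ⟧ℤ * ⟦ j ⟧ℤ
  +-*-homo m (ℤ.+ n) = begin
    ⟦ ℤ.+ m ℤ.* ℤ.+ n ⟧ℤ  ≡⟨ cong ⟦_⟧ℤ (ℤ.pos-* m n) ⟨
    ⟦ m ℕ.* n ⟧ℕ    ≈⟨ Mult.×1-homo-* m n ⟩
    ⟦ m ⟧ℕ * ⟦ n ⟧ℕ ∎
  +-*-homo m -[1+ n ] = begin
    ⟦ ℤ.+ m ℤ.* ℤ.- ℤ.+ suc n ⟧ℤ      ≡⟨ cong ⟦_⟧ℤ (ℤ.neg-distribʳ-* (ℤ.+ m) (ℤ.+ suc n)) ⟨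
    ⟦ ℤ.- (ℤ.+ m ℤ.* ℤ.+ suc n) ⟧ℤ    ≈⟨ -‿homo (ℤ.+ m ℤ.* ℤ.+ suc n) ⟩
    - ⟦ ℤ.+ m ℤ.* ℤ.+ suc n ⟧ℤ        ≈⟨ -‿cong (+-*-homo m (ℤ.+ suc n)) ⟩
    - (⟦ m ⟧ℕ * ⟦ suc n ⟧ℕ)   ≈⟨ -‿distribʳ-* _ _ ⟩
    ⟦ m ⟧ℕ * - ⟦ suc n ⟧ℕ     ∎

  *-homo : ∀ i j → ⟦ i ℤ.* j ⟧ℤ ≈ ⟦ i ⟧ℤ * ⟦ j ⟧ℤ
  *-homo (ℤ.+ m)    j = +-*-homo m j
  *-homo -[1+ m ] j = begin
    ⟦ ℤ.- ℤ.+ suc m ℤ.* j ⟧ℤ        ≡⟨ cong ⟦_⟧ℤ (ℤ.neg-distribˡ-* (ℤ.+ suc m) j) ⟨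
    ⟦ ℤ.- (ℤ.+ suc m ℤ.* j) ⟧ℤ      ≈⟨ -‿homo (ℤ.+ suc m ℤ.* j) ⟩
    - ⟦ ℤ.+ suc m ℤ.* j ⟧ℤ          ≈⟨ -‿cong (+-*-homo (suc m) j) ⟩
    - (⟦ suc m ⟧ℕ * ⟦ j ⟧ℤ)       ≈⟨ -‿distribˡ-* _ _ ⟩
    - ⟦ suc m ⟧ℕ * ⟦ j ⟧ℤ       ∎

  morphism : ℤ.+-*-rawRing -Raw-AlmostCommutative⟶ fromCommutativeRing R
  morphism = record
    { ⟦_⟧ = ⟦_⟧ℤ ; +-homo = +-homo ; *-homo = *-homo ; -‿homo = -‿homo
    ; 0-homo = ≈-refl ; 1-homo = +-identityʳ 1# }

  open import Algebra.Solver.Ring ℤ.+-*-rawRing (fromCommutativeRing R) morphism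
    (λ i j → Maybe.map (reflexive ∘ cong ⟦_⟧ℤ) (dec⇒maybe (i ℤ.≟ j))) public

module OrderedFieldProperties (F : OrderedField) where
  open OrderedField F

  commutativeRing : CommutativeRing 0ℓ 0ℓ
  commutativeRing = record { isCommutativeRing = isCommutativeRing }

  open CommutativeRing commutativeRing public
    using (_-_; +-comm; +-identityˡ; +-identityʳ; *-comm; *-identityˡ; *-identityʳ; -‿inverseʳ; zeroˡ; zeroʳ)
  open import Algebra.Properties.Ring (CommutativeRing.ring commutativeRing) public
    using (x∙y⁻¹≈ε⇒x≈y)
  open IntegerCoefficientSolver commutativeRing public using (solve; _:+_; _:*_; :-_; _:-_; _:=_)

  totalOrder : TotalOrder 0ℓ 0ℓ 0ℓ
  totalOrder = record { isTotalOrder = isTotalOrder }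

  open TotalOrder totalOrder public
    using () renaming (refl to ≤-refl; trans to ≤-trans; antisym to ≤-antisym; total to ≤-total)
  module ≤-Reasoning = PosetReasoning (TotalOrder.poset totalOrder)

  private variable
    a b c d : Carrier

  +-monoʳ-≤ : ∀ c → a ≤ b → c + a ≤ c + b
  +-monoʳ-≤ {a} {b} c a≤b = subst₂ _≤_ (+-comm a c) (+-comm b c) (+-monoˡ-≤ c a≤b)

  +-mono-≤ : a ≤ b → c ≤ d → a + c ≤ b + d
  +-mono-≤ {b = b} {c} a≤b c≤d = ≤-trans (+-monoˡ-≤ c a≤b) (+-monoʳ-≤ b c≤d)

  +-cancelˡ-≤ : ∀ c → c + a ≤ c + b → a ≤ b
  +-cancelˡ-≤ {a} {b} c le = subst₂ _≤_ (cancel a) (cancel b) (+-monoʳ-≤ (- c) le)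
    where
    cancel : ∀ x → - c + (c + x) ≡ x
    cancel = solve 2 (λ c x → :- c :+ (c :+ x) := x) refl c

  x≤y⇒0≤y-x : a ≤ b → 0# ≤ b - a
  x≤y⇒0≤y-x {a} {b} a≤b = subst (_≤ b - a) (-‿inverseʳ a) (+-monoˡ-≤ (- a) a≤b)

  0≤y-x⇒x≤y : 0# ≤ b - a → a ≤ b
  0≤y-x⇒x≤y {b} {a} le = subst₂ _≤_ (+-identityˡ a) (solve 2 (λ a b → b :- a :+ a := b) refl a b) (+-monoˡ-≤ a le)

  x-y≡0⇒x≡y : a - b ≡ 0# → a ≡ b
  x-y≡0⇒x≡y = x∙y⁻¹≈ε⇒x≈y _ _

  0≤x⇒y≤x+y : 0# ≤ a → b ≤ a + b
  0≤x⇒y≤x+y {a} {b} 0≤a = subst (_≤ a + b) (+-identityˡ b) (+-monoˡ-≤ b 0≤a)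

  0≤x*x : ∀ x → 0# ≤ x * x
  0≤x*x x with ≤-total 0# x
  ... | inj₁ 0≤x = *-nonneg 0≤x 0≤x
  ... | inj₂ x≤0 = subst (0# ≤_) (solve 1 (λ x → :- x :* :- x := x :* x) refl x) (*-nonneg 0≤-x 0≤-x)
    where
    0≤-x : 0# ≤ - x
    0≤-x = subst (_≤ - x) (-‿inverseʳ x) (subst (x - x ≤_) (+-identityˡ (- x)) (+-monoˡ-≤ (- x) x≤0))

  0≤1 : 0# ≤ 1#
  0≤1 = subst (0# ≤_) (*-identityˡ 1#) (0≤x*x 1#)

  x≢0∧xy≡0⇒y≡0 : a ≢ 0# → a * b ≡ 0# → b ≡ 0#
  x≢0∧xy≡0⇒y≡0 {a} {b} a≢0 ab≡0 with inverse a a≢0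
  ... | a⁻¹ , aa⁻¹≡1 = begin
    b              ≡⟨ *-identityˡ b ⟨
    1# * b         ≡⟨ cong (_* b) aa⁻¹≡1 ⟨
    a * a⁻¹ * b    ≡⟨ solve 3 (λ a a⁻¹ b → a :* a⁻¹ :* b := a⁻¹ :* (a :* b)) refl a a⁻¹ b ⟩
    a⁻¹ * (a * b)  ≡⟨ cong (a⁻¹ *_) ab≡0 ⟩
    a⁻¹ * 0#       ≡⟨ zeroʳ a⁻¹ ⟩
    0#             ∎
    where open ≡-Reasoning

  0≤x∧0≤y∧x+y≡0⇒x≡0×y≡0 : 0# ≤ a → 0# ≤ b → a + b ≡ 0# → a ≡ 0# × b ≡ 0#
  0≤x∧0≤y∧x+y≡0⇒x≡0×y≡0 {a} {b} 0≤a 0≤b a+b≡0 =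
    ≤-antisym (subst₂ _≤_ (+-identityʳ a) a+b≡0 (+-monoʳ-≤ a 0≤b)) 0≤a ,
    ≤-antisym (subst (b ≤_) a+b≡0 (0≤x⇒y≤x+y 0≤a)) 0≤b

  open Geometry F using (sumF)
  open import Algebra.Properties.Semiring.Sum (CommutativeRing.semiring commutativeRing)
    using (sum; sum-cong-≋; sum-replicate-zero; ∑-distrib-+; ∑-comm; *-distribˡ-sum; *-distribʳ-sum)

  sumF≡sum : ∀ {k} (f : Fin k → Carrier) → sumF f ≡ sum f
  sumF≡sum {zero}  f = refl
  sumF≡sum {suc k} f = cong (f zero +_) (sumF≡sum (λ i → f (suc i)))

  module _ {k : ℕ} where

    sumF-cong : {f g : Fin k → Carrier} → (∀ i → f i ≡ g i) → sumF f ≡ sumF g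
    sumF-cong {f} {g} f≗g rewrite sumF≡sum f | sumF≡sum g = sum-cong-≋ f≗g

    sumF-zeros : sumF {k} (λ _ → 0#) ≡ 0#
    sumF-zeros rewrite sumF≡sum {k} (λ _ → 0#) = sum-replicate-zero k

    sumF-+ : (f g : Fin k → Carrier) → sumF (λ i → f i + g i) ≡ sumF f + sumF g
    sumF-+ f g rewrite sumF≡sum (λ i → f i + g i) | sumF≡sum f | sumF≡sum g = ∑-distrib-+ f g

    sumF-*ˡ : ∀ x (f : Fin k → Carrier) → sumF (λ i → x * f i) ≡ x * sumF f
    sumF-*ˡ x f rewrite sumF≡sum (λ i → x * f i) | sumF≡sum f = sym (*-distribˡ-sum x f)

    sumF-*ʳ : ∀ x (f : Fin k → Carrier) → sumF (λ i → f i * x) ≡ sumF f * x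
    sumF-*ʳ x f rewrite sumF≡sum (λ i → f i * x) | sumF≡sum f = sym (*-distribʳ-sum x f)

  sumF-comm : ∀ {m n} (f : Fin m → Fin n → Carrier) →
              sumF (λ i → sumF (f i)) ≡ sumF (λ j → sumF (λ i → f i j))
  sumF-comm f = begin
    sumF (λ i → sumF (f i))              ≡⟨ sumF-cong (λ i → sumF≡sum (f i)) ⟩
    sumF (λ i → sum (f i))               ≡⟨ sumF≡sum (λ i → sum (f i)) ⟩
    sum (λ i → sum (f i))                ≡⟨ ∑-comm f ⟩
    sum (λ j → sum (λ i → f i j))        ≡⟨ sumF≡sum (λ j → sum (λ i → f i j)) ⟨
    sumF (λ j → sum (λ i → f i j))       ≡⟨ sumF-cong (λ j → sumF≡sum (λ i → f i j)) ⟨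
    sumF (λ j → sumF (λ i → f i j))      ∎
    where open ≡-Reasoning

  sumF-- : ∀ {k} (f g : Fin k → Carrier) → sumF (λ i → f i - g i) ≡ sumF f - sumF g
  sumF-- {zero}  f g = sym (-‿inverseʳ 0#)
  sumF-- {suc k} f g = trans (cong (f zero - g zero +_) (sumF-- (λ i → f (suc i)) (λ i → g (suc i))))
    (solve 4 (λ x y X Y → x :- y :+ (X :- Y) := x :+ X :- (y :+ Y)) refl _ _ _ _)

  sumF-mono-≤ : ∀ {k} {f g : Fin k → Carrier} → (∀ i → f i ≤ g i) → sumF f ≤ sumF g
  sumF-mono-≤ {zero}  f≤g = ≤-refl
  sumF-mono-≤ {suc k} f≤g = +-mono-≤ (f≤g zero) (sumF-mono-≤ (λ i → f≤g (suc i)))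

  sumF-nonneg : ∀ {k} {f : Fin k → Carrier} → (∀ i → 0# ≤ f i) → 0# ≤ sumF f
  sumF-nonneg {k} {f} 0≤f = subst (_≤ sumF f) (sumF-zeros {k}) (sumF-mono-≤ 0≤f)

  sumF-nonneg≡0⇒≡0 : ∀ {k} {f : Fin k → Carrier} → (∀ i → 0# ≤ f i) → sumF f ≡ 0# → ∀ i → f i ≡ 0#
  sumF-nonneg≡0⇒≡0 {suc k} 0≤f Σf≡0 i with 0≤x∧0≤y∧x+y≡0⇒x≡0×y≡0 (0≤f zero) (sumF-nonneg (λ i → 0≤f (suc i))) Σf≡0
  sumF-nonneg≡0⇒≡0 {suc k} 0≤f Σf≡0 zero    | f₀≡0 , _ = f₀≡0
  sumF-nonneg≡0⇒≡0 {suc k} 0≤f Σf≡0 (suc i) | _ , Σf'≡0 = sumF-nonneg≡0⇒≡0 (λ i → 0≤f (suc i)) Σf'≡0 i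

  term≤sumF : ∀ {k} {f : Fin k → Carrier} → (∀ i → 0# ≤ f i) → ∀ i → f i ≤ sumF f
  term≤sumF {suc k} {f} 0≤f zero    = subst (_≤ sumF f) (+-identityʳ (f zero)) (+-monoʳ-≤ (f zero) (sumF-nonneg (λ i → 0≤f (suc i))))
  term≤sumF {suc k} {f} 0≤f (suc i) = ≤-trans (term≤sumF (λ i → 0≤f (suc i)) i) (0≤x⇒y≤x+y (0≤f zero))

  δ : ∀ {n} → Fin n → Fin n → Carrier
  δ zero    zero    = 1#
  δ zero    (suc _) = 0#
  δ (suc _) zero    = 0#
  δ (suc i) (suc j) = δ i j

  δ-nonneg : ∀ {n} (i j : Fin n) → 0# ≤ δ i j
  δ-nonneg zero    zero    = 0≤1
  δ-nonneg zero    (suc _) = ≤-refl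
  δ-nonneg (suc _) zero    = ≤-refl
  δ-nonneg (suc i) (suc j) = δ-nonneg i j

  sumF-δ* : ∀ {n} (i : Fin n) (g : Fin n → Carrier) → sumF (λ j → δ i j * g j) ≡ g i
  sumF-δ* {suc n} zero g = begin
    1# * g zero + sumF (λ j → 0# * g (suc j))  ≡⟨ cong₂ _+_ (*-identityˡ (g zero)) (sumF-cong (λ j → zeroˡ (g (suc j)))) ⟩
    g zero + sumF {n} (λ _ → 0#)               ≡⟨ cong (g zero +_) (sumF-zeros {n}) ⟩
    g zero + 0#                                ≡⟨ +-identityʳ (g zero) ⟩
    g zero                                     ∎
    where open ≡-Reasoning
  sumF-δ* {suc n} (suc i) g = trans (cong₂ _+_ (zeroˡ (g zero)) (sumF-δ* i (λ j → g (suc j)))) (+-identityˡ (g (suc i)))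

  sumF-δ : ∀ {n} (i : Fin n) → sumF (δ i) ≡ 1#
  sumF-δ i = trans (sumF-cong (λ j → sym (*-identityʳ (δ i j)))) (sumF-δ* i (λ _ → 1#))

SimplicesOfSize≤ : ∀ {N} → ℕ → SC N → Set
SimplicesOfSize≤ b K = ∀ s → K s → ∣ s ∣ ℕ.≤ b

∣p∪q∣≤∣p∣+∣q∣ : ∀ {n} (p q : Subset n) → ∣ p ∪ q ∣ ℕ.≤ ∣ p ∣ ℕ.+ ∣ q ∣
∣p∪q∣≤∣p∣+∣q∣ []            []            = z≤n
∣p∪q∣≤∣p∣+∣q∣ (outside ∷ p) (outside ∷ q) = ∣p∪q∣≤∣p∣+∣q∣ p q
∣p∪q∣≤∣p∣+∣q∣ (outside ∷ p) (inside  ∷ q) = subst (suc ∣ p ∪ q ∣ ℕ.≤_) (sym (ℕ.+-suc ∣ p ∣ ∣ q ∣)) (s≤s (∣p∪q∣≤∣p∣+∣q∣ p q))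
∣p∪q∣≤∣p∣+∣q∣ (inside  ∷ p) (outside ∷ q) = s≤s (∣p∪q∣≤∣p∣+∣q∣ p q)
∣p∪q∣≤∣p∣+∣q∣ (inside  ∷ p) (inside  ∷ q) = s≤s (ℕ.≤-trans (∣p∪q∣≤∣p∣+∣q∣ p q) (ℕ.+-monoʳ-≤ ∣ p ∣ (ℕ.n≤1+n ∣ q ∣)))

∣x∷p∣≤1+∣p∣ : ∀ {n} x (p : Subset n) → ∣ x ∷ p ∣ ℕ.≤ suc ∣ p ∣
∣x∷p∣≤1+∣p∣ outside p = ℕ.n≤1+n ∣ p ∣
∣x∷p∣≤1+∣p∣ inside  p = ℕ.≤-refl

graphComplex-simplicesOfSize≤2 : ∀ {n} (G : SimpleGraph n) → SimplicesOfSize≤ 2 (graphComplex G)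
graphComplex-simplicesOfSize≤2 G s (inj₁ ∣s∣≤1)                = ℕ.m≤n⇒m≤1+n ∣s∣≤1
graphComplex-simplicesOfSize≤2 G _ (inj₂ (u , v , _ , refl)) =
  ℕ.≤-trans (∣p∪q∣≤∣p∣+∣q∣ ⁅ u ⁆ ⁅ v ⁆) (ℕ.≤-reflexive (cong₂ ℕ._+_ (∣⁅x⁆∣≡1 u) (∣⁅x⁆∣≡1 v)))

Cone-simplicesOfSize≤ : ∀ {N b} {K : SC N} → SimplicesOfSize≤ b K → SimplicesOfSize≤ (suc b) (Cone K)
Cone-simplicesOfSize≤ K≤b (x ∷ s) Ks = ℕ.≤-trans (∣x∷p∣≤1+∣p∣ x s) (s≤s (K≤b s Ks))

iterCone-simplicesOfSize≤ : ∀ {N b} {K : SC N} j → SimplicesOfSize≤ b K → SimplicesOfSize≤ (j ℕ.+ b) (iterCone j K)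
iterCone-simplicesOfSize≤ zero    K≤b = K≤b
iterCone-simplicesOfSize≤ (suc j) K≤b = Cone-simplicesOfSize≤ (iterCone-simplicesOfSize≤ j K≤b)

Cone-apexFree-size≤ : ∀ {N b} {K : SC N} → SimplicesOfSize≤ b K →
                      ∀ {T} → Cone K T → zero ∉ T → ∣ T ∣ ℕ.≤ b
Cone-apexFree-size≤ K≤b {outside ∷ s} Ks _     = K≤b s Ks
Cone-apexFree-size≤ K≤b {inside  ∷ s} _  0∉T = contradiction here 0∉T

injective⇒≤∣p∣ : ∀ {r N} {f : Fin r → Fin N} (p : Subset N) → Injective _≡_ _≡_ f → (∀ i → f i ∈ p) → r ℕ.≤ ∣ p ∣
injective⇒≤∣p∣ {zero}          p f-inj f∈p = z≤n
injective⇒≤∣p∣ {suc r} {f = f} p f-inj f∈p = ℕ.≤-trans (s≤s r≤∣p-f₀∣) (x∈p⇒∣p-x∣<∣p∣ (f∈p zero))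
  where
  open Data.Fin.Subset using (_-_)
  r≤∣p-f₀∣ : r ℕ.≤ ∣ p - f zero ∣
  r≤∣p-f₀∣ = injective⇒≤∣p∣ (p - f zero) (λ e → suc-injective (f-inj e))
    (λ i → x∈p∧x≢y⇒x∈p-y (f∈p (suc i)) (λ e → 0≢1+n (sym (f-inj e))))

image : ∀ {r N} → (Fin r → Fin N) → Subset N
image f = tabulate (λ t → does (any? (λ i → f i ≟ t)))

∈-image⁺ : ∀ {r N} (f : Fin r → Fin N) i → f i ∈ image f
∈-image⁺ f i = lookup⇒[]= (f i) (image f)
  (trans (lookup∘tabulate _ (f i)) (dec-true (any? (λ i' → f i' ≟ f i)) (i , refl)))

∈-image⁻ : ∀ {r N} (f : Fin r → Fin N) {t} → t ∈ image f → ∃[ i ] f i ≡ t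
∈-image⁻ f {t} t∈image
  with any? (λ i → f i ≟ t) | trans (sym (lookup∘tabulate _ t)) ([]=⇒lookup t∈image)
... | yes ∃i | _  = ∃i
... | no _   | ()

module Polytopes (F : OrderedField) where
  open OrderedField F
  open OrderedFieldProperties F
  open Geometry F
  open RawMonad (¬¬-Monad {0ℓ}) using (_>>=_; pure; rawApplicative)

  ¬¬-decide : ∀ {n} (P : Fin n → Set) → ¬ ¬ (∀ i → Dec (P i))
  ¬¬-decide P = sequence rawApplicative (λ _ → ¬¬-excluded-middle)

  argmax : ∀ {k} → (Fin (suc k) → Carrier) → Fin (suc k)
  argmax f = Extrema.argmax totalOrder f zero (allFin _)

  ≤-argmax : ∀ {k} (f : Fin (suc k) → Carrier) i → f i ≤ f (argmax f)
  ≤-argmax f i = Extrema.v≤f[argmax]⁺ totalOrder zero (allFin _) (inj₂ (Any.map (λ { refl → ≤-refl }) (∈-allFin i)))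

  ∥_∥² : ∀ {q} → Point q → Carrier
  ∥ y ∥² = y · y

  _⊖_ : ∀ {q} → Point q → Point q → Point q
  (x ⊖ y) c = x c - y c

  0≤∥∥² : ∀ {q} (y : Point q) → 0# ≤ ∥ y ∥²
  0≤∥∥² y = sumF-nonneg (λ c → 0≤x*x (y c))

  vertex∈ : ∀ {q} {P : PointSet q} {v} → IsVertex P v → P v
  vertex∈ {v = v} (_ , _ , _ , face⇔v) = proj₁ (Equivalence.from (face⇔v v) (λ _ → refl))

  module ConvexHull {q k} (V : Fin (suc k) → Point q) where

    V∈Conv : ∀ i → Conv V (V i)
    V∈Conv i = δ i , δ-nonneg i , sumF-δ i , λ c → sym (sumF-δ* i (λ j → V j c))

    ·-conv : ∀ a {x} (w : Fin (suc k) → Carrier) → (∀ c → x c ≡ sumF (λ i → w i * V i c)) →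
             a · x ≡ sumF (λ i → w i * (a · V i))
    ·-conv a {x} w x≡ΣwV = begin
      sumF (λ c → a c * x c)                          ≡⟨ sumF-cong (λ c → cong (a c *_) (x≡ΣwV c)) ⟩
      sumF (λ c → a c * sumF (λ i → w i * V i c))     ≡⟨ sumF-cong (λ c → sym (sumF-*ˡ (a c) (λ i → w i * V i c))) ⟩
      sumF (λ c → sumF (λ i → a c * (w i * V i c)))   ≡⟨ sumF-comm (λ c i → a c * (w i * V i c)) ⟩
      sumF (λ i → sumF (λ c → a c * (w i * V i c)))   ≡⟨ sumF-cong (λ i → sumF-cong (λ c → x*[y*z]≡y*[x*z] (a c) (w i) (V i c))) ⟩
      sumF (λ i → sumF (λ c → w i * (a c * V i c)))   ≡⟨ sumF-cong (λ i → sumF-*ˡ (w i) (λ c → a c * V i c)) ⟩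
      sumF (λ i → w i * (a · V i))                    ∎
      where
      open ≡-Reasoning
      x*[y*z]≡y*[x*z] : ∀ x y z → x * (y * z) ≡ y * (x * z)
      x*[y*z]≡y*[x*z] = solve 3 (λ x y z → x :* (y :* z) := y :* (x :* z)) refl

    slack-conv : ∀ a b {x} w → sumF w ≡ 1# → (∀ c → x c ≡ sumF (λ i → w i * V i c)) →
                 b - a · x ≡ sumF (λ i → w i * (b - a · V i))
    slack-conv a b {x} w Σw≡1 x≡ΣwV = sym (begin
      sumF (λ i → w i * (b - a · V i))                       ≡⟨ sumF-cong (λ i → distrib (w i) b (a · V i)) ⟩
      sumF (λ i → b * w i - w i * (a · V i))                 ≡⟨ sumF-- (λ i → b * w i) (λ i → w i * (a · V i)) ⟩
      sumF (λ i → b * w i) - sumF (λ i → w i * (a · V i))    ≡⟨ cong₂ _-_ (sumF-*ˡ b w) (sym (·-conv a w x≡ΣwV)) ⟩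
      b * sumF w - a · x                                     ≡⟨ cong (λ s → b * s - a · x) Σw≡1 ⟩
      b * 1# - a · x                                         ≡⟨ cong (_- a · x) (*-identityʳ b) ⟩
      b - a · x                                              ∎)
      where
      open ≡-Reasoning
      distrib : ∀ w b t → w * (b - t) ≡ b * w - w * t
      distrib = solve 3 (λ w b t → w :* (b :- t) := b :* w :- w :* t) refl

    conv-supported : ∀ {a b} → (∀ i → a · V i ≤ b) → Supporting (Conv V) a b
    conv-supported {a} {b} aV≤b x (w , 0≤w , Σw≡1 , x≡ΣwV) = 0≤y-x⇒x≤y
      (subst (0# ≤_) (sym (slack-conv a b w Σw≡1 x≡ΣwV))
        (sumF-nonneg (λ i → *-nonneg (0≤w i) (x≤y⇒0≤y-x (aV≤b i)))))

    conv-on-hyperplane : ∀ {a b x} → (∀ i → a · V i ≡ b) → Conv V x → a · x ≡ b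
    conv-on-hyperplane {a} {b} {x} aV≡b (w , _ , Σw≡1 , x≡ΣwV) = sym (x-y≡0⇒x≡y (begin
      b - a · x                          ≡⟨ slack-conv a b w Σw≡1 x≡ΣwV ⟩
      sumF (λ i → w i * (b - a · V i))   ≡⟨ sumF-cong (λ i → cong (λ t → w i * (b - t)) (aV≡b i)) ⟩
      sumF (λ i → w i * (b - b))         ≡⟨ sumF-cong (λ i → trans (cong (w i *_) (-‿inverseʳ b)) (zeroʳ (w i))) ⟩
      sumF {suc k} (λ _ → 0#)            ≡⟨ sumF-zeros {suc k} ⟩
      0#                                 ∎))
      where open ≡-Reasoning

    not-all-on-facet : ∀ {d a b} → HasDim (Conv V) (suc d) → HasDim (Face (Conv V) a b) d →
                       ¬ (∀ i → a · V i ≡ b)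
    not-all-on-facet ((p , p∈P , p-affInd) , _) (_ , ¬affInd) aV≡b =
      ¬affInd p (λ i → p∈P i , conv-on-hyperplane aV≡b (p∈P i)) p-affInd

    exposed⇒vertex : ∀ a i₀ → (∀ i c → Dec (V i c ≡ V i₀ c)) → (∀ i → a · V i ≤ a · V i₀) →
                     (∀ i c → V i c ≢ V i₀ c → a · V i ≢ a · V i₀) → IsVertex (Conv V) (V i₀)
    exposed⇒vertex a i₀ V≟v aV≤av strict =
      a , a · v , conv-supported aV≤av , λ x → mk⇔ (face⇒≐v x) (≐v⇒face x)
      where
      v : Point q
      v = V i₀

      face⇒≐v : ∀ x → Face (Conv V) a (a · v) x → x ≐ v
      face⇒≐v x ((w , 0≤w , Σw≡1 , x≡ΣwV) , ax≡av) c = begin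
        x c                        ≡⟨ x≡ΣwV c ⟩
        sumF (λ i → w i * V i c)   ≡⟨ sumF-cong wV≡wv ⟩
        sumF (λ i → w i * v c)     ≡⟨ sumF-*ʳ (v c) w ⟩
        sumF w * v c               ≡⟨ cong (_* v c) Σw≡1 ⟩
        1# * v c                   ≡⟨ *-identityˡ (v c) ⟩
        v c                        ∎
        where
        open ≡-Reasoning
        w*slack≡0 : ∀ i → w i * (a · v - a · V i) ≡ 0#
        w*slack≡0 = sumF-nonneg≡0⇒≡0 (λ i → *-nonneg (0≤w i) (x≤y⇒0≤y-x (aV≤av i)))
          (trans (sym (slack-conv a (a · v) w Σw≡1 x≡ΣwV)) (trans (cong (λ t → a · v - t) ax≡av) (-‿inverseʳ (a · v))))
        wV≡wv : ∀ i → w i * V i c ≡ w i * v c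
        wV≡wv i with V≟v i c
        ... | yes Vic≡vc = cong (w i *_) Vic≡vc
        ... | no  Vic≢vc = trans (cong (_* V i c) wᵢ≡0) (trans (zeroˡ (V i c)) (sym (trans (cong (_* v c) wᵢ≡0) (zeroˡ (v c)))))
          where
          slack≢0 : a · v - a · V i ≢ 0#
          slack≢0 slack≡0 = strict i c Vic≢vc (sym (x-y≡0⇒x≡y slack≡0))
          wᵢ≡0 : w i ≡ 0#
          wᵢ≡0 = x≢0∧xy≡0⇒y≡0 slack≢0 (trans (*-comm _ (w i)) (w*slack≡0 i))

      ≐v⇒face : ∀ x → x ≐ v → Face (Conv V) a (a · v) x
      ≐v⇒face x x≐v with V∈Conv i₀
      ... | w , 0≤w , Σw≡1 , v≡ΣwV = (w , 0≤w , Σw≡1 , λ c → trans (x≐v c) (v≡ΣwV c)) , sumF-cong (λ c → cong (a c *_) (x≐v c))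

    module ExposedVertexOffHyperplane
      {A : Point q} {B : Carrier} (AV≤B : ∀ i → A · V i ≤ B) (j : Fin (suc k)) (AVj≢B : A · V j ≢ B) where

      h K : Carrier
      h = B - A · V j
      K = sumF (λ i → ∥ V i ∥²) + 1#

      Φ : Point q → Carrier
      Φ y = h * ∥ y ∥² - K * (A · y)

      i₀ : Fin (suc k)
      i₀ = argmax (λ i → Φ (V i))

      v a : Point q
      v = V i₀
      -- the gradient of Φ at v
      a c = (h + h) * v c - K * A c

      0≤h : 0# ≤ h
      0≤h = x≤y⇒0≤y-x (AV≤B j)

      h≢0 : h ≢ 0#
      h≢0 h≡0 = AVj≢B (sym (x-y≡0⇒x≡y h≡0))

      Φ≡sumF : ∀ y → Φ y ≡ sumF (λ c → h * (y c * y c) - K * (A c * y c))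
      Φ≡sumF y = sym (trans (sumF-- (λ c → h * (y c * y c)) (λ c → K * (A c * y c)))
                            (cong₂ _-_ (sumF-*ˡ h (λ c → y c * y c)) (sumF-*ˡ K (λ c → A c * y c))))

      Φ+a·v≡Φv+a·y+dist : ∀ y → Φ y + a · v ≡ Φ v + (a · y + h * ∥ y ⊖ v ∥²)
      Φ+a·v≡Φv+a·y+dist y = begin
        Φ y + a · v
          ≡⟨ cong (_+ a · v) (Φ≡sumF y) ⟩
        sumF (φ y) + a · v
          ≡⟨ sumF-+ (φ y) (λ c → a c * v c) ⟨
        sumF (λ c → φ y c + a c * v c)
          ≡⟨ sumF-cong (λ c → pointwise h K (A c) (y c) (v c)) ⟩
        sumF (λ c → φ v c + (a c * y c + h * ((y ⊖ v) c * (y ⊖ v) c)))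
          ≡⟨ sumF-+ (φ v) _ ⟩
        sumF (φ v) + sumF (λ c → a c * y c + h * ((y ⊖ v) c * (y ⊖ v) c))
          ≡⟨ cong₂ _+_ (sym (Φ≡sumF v)) (trans (sumF-+ (λ c → a c * y c) (λ c → h * ((y ⊖ v) c * (y ⊖ v) c)))
                                                  (cong (a · y +_) (sumF-*ˡ h (λ c → (y ⊖ v) c * (y ⊖ v) c)))) ⟩
        Φ v + (a · y + h * ∥ y ⊖ v ∥²)
          ∎
        where
        open ≡-Reasoning
        φ : Point q → Fin q → Carrier
        φ y c = h * (y c * y c) - K * (A c * y c)
        pointwise : ∀ h K A y v → h * (y * y) - K * (A * y) + ((h + h) * v - K * A) * v ≡
                    h * (v * v) - K * (A * v) + (((h + h) * v - K * A) * y + h * ((y - v) * (y - v)))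
        pointwise = solve 5 (λ h K A y v →
          h :* (y :* y) :- K :* (A :* y) :+ ((h :+ h) :* v :- K :* A) :* v :=
          h :* (v :* v) :- K :* (A :* v) :+ (((h :+ h) :* v :- K :* A) :* y :+ h :* ((y :- v) :* (y :- v)))) refl

      0≤dist : ∀ i → 0# ≤ h * ∥ V i ⊖ v ∥²
      0≤dist i = *-nonneg 0≤h (0≤∥∥² (V i ⊖ v))

      aV+dist≤av : ∀ i → a · V i + h * ∥ V i ⊖ v ∥² ≤ a · v
      aV+dist≤av i = +-cancelˡ-≤ (Φ v) (begin
        Φ v + (a · V i + h * ∥ V i ⊖ v ∥²)  ≡⟨ Φ+a·v≡Φv+a·y+dist (V i) ⟨
        Φ (V i) + a · v                      ≤⟨ +-monoˡ-≤ (a · v) (≤-argmax (λ i → Φ (V i)) i) ⟩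
        Φ v + a · v                          ∎)
        where open ≤-Reasoning

      aV≤av : ∀ i → a · V i ≤ a · v
      aV≤av i = ≤-trans (subst (_≤ a · V i + h * ∥ V i ⊖ v ∥²) (+-identityʳ (a · V i)) (+-monoʳ-≤ (a · V i) (0≤dist i))) (aV+dist≤av i)

      aV≢av : ∀ i c → V i c ≢ v c → a · V i ≢ a · v
      aV≢av i c Vic≢vc aVi≡av = dᶜ≢0 (x≢0∧xy≡0⇒y≡0 dᶜ≢0 dᶜ²≡0)
        where
        dᶜ≢0 : V i c - v c ≢ 0#
        dᶜ≢0 dᶜ≡0 = Vic≢vc (x-y≡0⇒x≡y dᶜ≡0)
        dist≡0 : h * ∥ V i ⊖ v ∥² ≡ 0#
        dist≡0 = ≤-antisym
          (+-cancelˡ-≤ (a · v) (subst₂ _≤_ (cong (_+ h * ∥ V i ⊖ v ∥²) aVi≡av) (sym (+-identityʳ (a · v))) (aV+dist≤av i)))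
          (0≤dist i)
        dᶜ²≡0 : (V i c - v c) * (V i c - v c) ≡ 0#
        dᶜ²≡0 = sumF-nonneg≡0⇒≡0 (λ c → 0≤x*x ((V i ⊖ v) c)) (x≢0∧xy≡0⇒y≡0 h≢0 dist≡0) c

      Av≢B : A · v ≢ B
      Av≢B Av≡B = hp≢0 (≤-antisym hp≤0 0≤hp)
        where
        p : Carrier
        p = ∥ V j ∥² - ∥ v ∥² + K
        Φ[Vj]≡Φv+hp : Φ (V j) ≡ Φ v + h * p
        Φ[Vj]≡Φv+hp = trans (identity B (A · V j) ∥ V j ∥² ∥ v ∥² K) (cong (λ t → h * ∥ v ∥² - K * t + h * p) (sym Av≡B))
          where
          identity : ∀ B t nj nv K → (B - t) * nj - K * t ≡ (B - t) * nv - K * B + (B - t) * (nj - nv + K)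
          identity = solve 5 (λ B t nj nv K →
            (B :- t) :* nj :- K :* t := (B :- t) :* nv :- K :* B :+ (B :- t) :* (nj :- nv :+ K)) refl
        1≤p : 1# ≤ p
        1≤p = begin
          1#                                                   ≡⟨ +-identityˡ 1# ⟨
          0# + 1#                                              ≤⟨ +-monoˡ-≤ 1# (≤-trans (x≤y⇒0≤y-x ∥v∥²≤S) (0≤x⇒y≤x+y (0≤∥∥² (V j)))) ⟩
          ∥ V j ∥² + (sumF (λ i → ∥ V i ∥²) - ∥ v ∥²) + 1#     ≡⟨ solve 4 (λ nj S nv o → nj :+ (S :- nv) :+ o := nj :- nv :+ (S :+ o)) refl _ _ _ 1# ⟩
          p                                                    ∎
          where
          open ≤-Reasoning
          ∥v∥²≤S : ∥ v ∥² ≤ sumF (λ i → ∥ V i ∥²)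
          ∥v∥²≤S = term≤sumF (λ i → 0≤∥∥² (V i)) i₀
        0≤hp : 0# ≤ h * p
        0≤hp = *-nonneg 0≤h (≤-trans 0≤1 1≤p)
        hp≤0 : h * p ≤ 0#
        hp≤0 = +-cancelˡ-≤ (Φ v) (subst₂ _≤_ Φ[Vj]≡Φv+hp (sym (+-identityʳ (Φ v))) (≤-argmax (λ i → Φ (V i)) j))
        hp≢0 : h * p ≢ 0#
        hp≢0 hp≡0 = 0≢1 (≤-antisym 0≤1 (subst (1# ≤_) (x≢0∧xy≡0⇒y≡0 h≢0 hp≡0) 1≤p))

      vertex-off : (∀ i c → Dec (V i c ≡ v c)) → ∃[ v ] (IsVertex (Conv V) v × A · v ≢ B)
      vertex-off V≟v = v , exposed⇒vertex a i₀ V≟v aV≤av aV≢av , Av≢B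

    -- Equality in F is not decidable, but the goal is a negation, so the finitely many
    -- equations involved may be decided under ¬¬.
    vertex-off-facet : ∀ {d A B} → HasDim (Conv V) (suc d) → IsFacet (Conv V) d A B →
                       ¬ ¬ (∃[ v ] (IsVertex (Conv V) v × A · v ≢ B))
    vertex-off-facet {A = A} {B} dimP (supp , dimF) = do
      AV≟B ← ¬¬-decide (λ i → A · V i ≡ B)
      let j , AVj≢B = ¬∀⟶∃¬ _ _ AV≟B (not-all-on-facet dimP dimF)
          open ExposedVertexOffHyperplane (λ i → supp (V i) (V∈Conv i)) j AVj≢B
      V≟v ← sequence rawApplicative (λ i → ¬¬-decide (λ c → V i c ≡ v c))
      pure (vertex-off V≟v)

  facetsAtVertex-simplex : ∀ {q m d N} {P : PointSet q} {E : FacetEnum P d m} {K : SC N} →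
    IsSimple P d E → (dual : DualIso P E K) → ∀ {v} → IsVertex P v →
    ∃[ T ] (K T × suc d ℕ.≤ ∣ T ∣ × (∀ t → t ∈ T → FacetEnum.facet E (Inverse.from (proj₁ dual) t) v))
  facetsAtVertex-simplex {d = d} {N} {E = E} simple (φ , K⇔) {v} isV with simple v isV
  ... | ι , ι-inj , ∈facet⇔ =
    image f , Equivalence.from (K⇔ (image f)) (v , vertex∈ isV , T⊆facets) ,
    injective⇒≤∣p∣ (image f) f-inj (∈-image⁺ f) , T⊆facets
    where
    f : Fin (suc d) → Fin N
    f k = Inverse.to φ (ι k)
    f-inj : Injective _≡_ _≡_ f
    f-inj e = ι-inj _ _ (Injection.injective (↔⇒↣ φ) e)
    T⊆facets : ∀ t → t ∈ image f → FacetEnum.facet E (Inverse.from φ t) v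
    T⊆facets t t∈T with ∈-image⁻ f t∈T
    ... | k , refl = subst (λ i → FacetEnum.facet E i v) (sym (Inverse.strictlyInverseʳ φ (ι k)))
                           (Equivalence.from (∈facet⇔ (ι k)) (k , refl))

  Cone-notDualToSimplePolytope : ∀ {d N} {K : SC N} → SimplicesOfSize≤ d K → ¬ DualToSimplePolytope d (Cone K)
  Cone-notDualToSimplePolytope {K = K} K≤d (q , k , V , dimP , m , E , simple , dual@(φ , _)) =
    vertex-off-facet dimP (isFacet apex) λ (v , isV , v∉apex) →
      let T , KT , d<∣T∣ , T⊆facets = facetsAtVertex-simplex {E = E} {K = Cone K} simple dual isV
      in ℕ.<⇒≱ d<∣T∣ (Cone-apexFree-size≤ K≤d KT (λ 0∈T → v∉apex (proj₂ (T⊆facets zero 0∈T))))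
    where
    open ConvexHull V
    open FacetEnum E
    apex : Fin m
    apex = Inverse.from φ zero

open import Data.Nat using (_≤_)

proposition4p15 : (F : OrderedField) → ∀ {n} (G : SimpleGraph n) → HasEdge G →
    ∃[ J ] (∀ j → 1 ≤ j → J ≤ j →
      ¬ Geometry.DualToSimplePolytope F (suc j) (iterCone j (graphComplex G)))
proposition4p15 F G _ = 1 , λ where
  (suc j) _ _ → Polytopes.Cone-notDualToSimplePolytope F
    (subst (λ b → SimplicesOfSize≤ b (iterCone j (graphComplex G))) (ℕ.+-comm j 2)
      (iterCone-simplicesOfSize≤ j (graphComplex-simplicesOfSize≤2 G)))
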